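{- Every TBRSC of dimension 1 is boolean representable.
   Context: A simplicial complex is a pair $(V,H)$ with $V$ finite nonempty, $H\subseteq 2^V$ containing all singletons and closed under subsets; its dimension is $\max\{|X|:X\in H\}-1$. A flat is a set $F\subseteq V$ such that $X\cup\{p\}\in H$ for every $X\in H$ with $X\subseteq F$ and every $p\in V\setminus F$. For a chain $F_0\subset\cdots\subset F_k$ of subsets, a transversal of its successive differences is a set $\{x_1,\dots,x_k\}$ with $x_i\in F_i\setminus F_{i-1}$. The complex is boolean representable (a BRSC) if it admits a boolean matrix representation; equivalently, every face is a transversal of the successive differences of some chain of flats. For $k\ge1$ the $k$-truncation of $(V,H)$ is $(V,H\cap P_{\le k}(V))$, where $P_{\le k}(V)$ is the set of subsets with at most $k$ elements. A TBRSC is a simplicial complex equal to the $k$-truncation of some BRSC for some $k\ge 1$. -}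

module Defs where

open import Data.Nat using (ℕ; suc; _≤_)
open import Data.Bool using (Bool; T)
open import Data.Fin using (Fin; zero; suc; inject₁)
open import Data.Fin.Subset using (Subset; ⁅_⁆; _∈_; _∉_; _⊆_; _⊂_; _∪_; ∣_∣)
open import Data.Product using (Σ; ∃; ∃-syntax; _×_)
open import Function.Bundles using (_⇔_)
open import Relation.Binary.PropositionalEquality using (_≡_)

record SimplicialComplex (n : ℕ) : Set where
  field
    H          : Subset n → Bool
    singletons : ∀ (i : Fin n) → T (H ⁅ i ⁆)
    downClosed : ∀ (X Y : Subset n) → Y ⊆ X → T (H X) → T (H Y)
open SimplicialComplex public

IsFace : ∀ {n} → SimplicialComplex n → Subset n → Set
IsFace K X = T (H K X)

HasDimension : ∀ {n} → SimplicialComplex n → ℕ → Set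
HasDimension K d =
  (∃[ X ] (IsFace K X × ∣ X ∣ ≡ suc d)) × (∀ X → IsFace K X → ∣ X ∣ ≤ suc d)

IsFlat : ∀ {n} → SimplicialComplex n → Subset n → Set
IsFlat {n} K F =
  ∀ (X : Subset n) → IsFace K X → X ⊆ F → ∀ (p : Fin n) → p ∉ F → IsFace K (X ∪ ⁅ p ⁆)

-- X is a transversal of the successive differences of a chain of flats
-- F 0 ⊂ F 1 ⊂ ... ⊂ F k : X = {x 1, ..., x k} with x i ∈ F i ∖ F (i-1).
-- (Here indices of x are shifted: x i ∈ F (i+1) ∖ F i for i : Fin k.)
IsTransversalOfFlatChain : ∀ {n} → SimplicialComplex n → Subset n → Set
IsTransversalOfFlatChain {n} K X =
  ∃[ k ] Σ (Fin (suc k) → Subset n) λ F → Σ (Fin k → Fin n) λ x →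
    (∀ i → IsFlat K (F i))
    × (∀ (i : Fin k) → F (inject₁ i) ⊂ F (suc i))
    × (∀ (i : Fin k) → x i ∈ F (suc i) × x i ∉ F (inject₁ i))
    × (∀ (j : Fin n) → (j ∈ X ⇔ (∃[ i ] (x i ≡ j))))

-- Boolean representable simplicial complex (via the flat-chain characterization)
IsBRSC : ∀ {n} → SimplicialComplex n → Set
IsBRSC K = ∀ X → IsFace K X → IsTransversalOfFlatChain K X

IsTruncation : ∀ {n} → ℕ → SimplicialComplex n → SimplicialComplex n → Set
IsTruncation k K K' = ∀ X → (IsFace K X ⇔ (IsFace K' X × ∣ X ∣ ≤ k))

IsTBRSC : ∀ {n} → SimplicialComplex n → Set
IsTBRSC {n} K =
  ∃[ k ] (1 ≤ k × Σ (SimplicialComplex n) λ K' → IsBRSC K' × IsTruncation k K K')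

{-# OPTIONS --safe #-}

-- K has an edge, so it is the k-truncation of a BRSC K' with k ≥ 2, and K, K' have the same edges.
-- Two distinct vertices c, d of a face of a BRSC are separated by a flat G of its chain, and then
-- every vertex e is adjacent to d (if e ∈ G) or to c (if e ∉ G): every edge dominates the graph.
-- Conversely, when every edge dominates, the complement of the open neighbourhood N(a) of a vertex
-- is independent and completely joined to N(a), hence a flat, and an edge ab is a transversal of
-- ∅ ⊂ V ∖ N(a) ⊂ V.
module Submission where

open import Defs
open import Data.Nat using (ℕ; suc; _+_; _≤_; z≤n; s≤s)
open import Data.Nat.Properties using (≤-trans; ≤-reflexive; +-suc; +-monoʳ-≤; n≤0⇒n≡0)
open import Data.Bool using (Bool; true; false; T)
open import Data.Bool.Properties using (T-≡)
open import Data.Fin using (Fin; zero; suc; inject₁; _<_; _≟_)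
open import Data.Fin.Properties using (<-cmp; suc-injective)
open import Data.Fin.Subset
open import Data.Fin.Subset.Properties
open import Data.Vec using (_∷_; []; tabulate)
open import Data.Vec.Properties using (lookup∘tabulate; []=⇒lookup; lookup⇒[]=)
open import Data.Product using (∃-syntax; _×_; _,_; proj₁; proj₂)
open import Data.Sum using (_⊎_; inj₁; inj₂; [_,_]; swap)
import Data.Sum as Sum
open import Function using (_∘_)
open import Function.Bundles using (_⇔_; mk⇔; Equivalence)
open import Relation.Binary.Definitions using (tri<; tri≈; tri>)
open import Relation.Binary.PropositionalEquality using (_≡_; _≢_; refl; sym; trans; cong; subst)
open import Relation.Nullary using (¬_; yes; no; contradiction)

private
  variable
    m : ℕ
    p q : Subset m
    x y : Fin m

x∈tabulate⇔T : ∀ {f : Fin m → Bool} → x ∈ tabulate f ⇔ T (f x)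
x∈tabulate⇔T {x = x} {f} = mk⇔
  (λ x∈ → Equivalence.from T-≡ (trans (sym (lookup∘tabulate f x)) ([]=⇒lookup x∈)))
  (λ fx → lookup⇒[]= x (tabulate f) (trans (lookup∘tabulate f x) (Equivalence.to T-≡ fx)))

x∈p⇒⁅x⁆⊆p : x ∈ p → ⁅ x ⁆ ⊆ p
x∈p⇒⁅x⁆⊆p {p = p} x∈p y∈⁅x⁆ = subst (_∈ p) (sym (x∈⁅y⁆⇒x≡y _ y∈⁅x⁆)) x∈p

x,y∈p⇒⁅x⁆∪⁅y⁆⊆p : x ∈ p → y ∈ p → ⁅ x ⁆ ∪ ⁅ y ⁆ ⊆ p
x,y∈p⇒⁅x⁆∪⁅y⁆⊆p x∈p y∈p z∈ = [ x∈p⇒⁅x⁆⊆p x∈p , x∈p⇒⁅x⁆⊆p y∈p ] (x∈p∪q⁻ _ _ z∈)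

∣p∪q∣≤∣p∣+∣q∣ : ∀ (p q : Subset m) → ∣ p ∪ q ∣ ≤ ∣ p ∣ + ∣ q ∣
∣p∪q∣≤∣p∣+∣q∣ []          []          = z≤n
∣p∪q∣≤∣p∣+∣q∣ (false ∷ p) (false ∷ q) = ∣p∪q∣≤∣p∣+∣q∣ p q
∣p∪q∣≤∣p∣+∣q∣ (false ∷ p) (true ∷ q)  =
  subst (suc ∣ p ∪ q ∣ ≤_) (sym (+-suc ∣ p ∣ ∣ q ∣)) (s≤s (∣p∪q∣≤∣p∣+∣q∣ p q))
∣p∪q∣≤∣p∣+∣q∣ (true ∷ p)  (b ∷ q)     =
  s≤s (≤-trans (∣p∪q∣≤∣p∣+∣q∣ p q) (+-monoʳ-≤ ∣ p ∣ (∣p∣≤∣x∷p∣ b q)))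

∣⁅x⁆∪⁅y⁆∣≤2 : ∀ (x y : Fin m) → ∣ ⁅ x ⁆ ∪ ⁅ y ⁆ ∣ ≤ 2
∣⁅x⁆∪⁅y⁆∣≤2 x y = ≤-trans (∣p∪q∣≤∣p∣+∣q∣ ⁅ x ⁆ ⁅ y ⁆)
  (≤-reflexive (trans (cong (_+ ∣ ⁅ y ⁆ ∣) (∣⁅x⁆∣≡1 x)) (cong suc (∣⁅x⁆∣≡1 y))))

∣p∣≡0⇒p≡⊥ : ∀ (p : Subset m) → ∣ p ∣ ≡ 0 → p ≡ ⊥
∣p∣≡0⇒p≡⊥ []          _    = refl
∣p∣≡0⇒p≡⊥ (false ∷ p) ∣p∣≡0 = cong (false ∷_) (∣p∣≡0⇒p≡⊥ p ∣p∣≡0)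

∣p∣≤1⇒p≡⊥⊎⁅x⁆ : ∀ (p : Subset m) → ∣ p ∣ ≤ 1 → p ≡ ⊥ ⊎ ∃[ x ] p ≡ ⁅ x ⁆
∣p∣≤1⇒p≡⊥⊎⁅x⁆ []          _           = inj₁ refl
∣p∣≤1⇒p≡⊥⊎⁅x⁆ (true ∷ p)  (s≤s ∣p∣≤0) = inj₂ (zero , cong (true ∷_) (∣p∣≡0⇒p≡⊥ p (n≤0⇒n≡0 ∣p∣≤0)))
∣p∣≤1⇒p≡⊥⊎⁅x⁆ (false ∷ p) ∣p∣≤1       =
  Sum.map (cong (false ∷_)) (λ (x , p≡⁅x⁆) → suc x , cong (false ∷_) p≡⁅x⁆) (∣p∣≤1⇒p≡⊥⊎⁅x⁆ p ∣p∣≤1)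

data AtMostTwo {m : ℕ} : Subset m → Set where
  empty     : AtMostTwo ⊥
  singleton : ∀ x → AtMostTwo ⁅ x ⁆
  pair      : x ≢ y → AtMostTwo (⁅ x ⁆ ∪ ⁅ y ⁆)

atMostTwo : ∀ (p : Subset m) → ∣ p ∣ ≤ 2 → AtMostTwo p
atMostTwo []          _           = empty
atMostTwo (false ∷ p) ∣p∣≤2       with atMostTwo p ∣p∣≤2
... | empty       = empty
... | singleton x = singleton (suc x)
... | pair x≢y    = pair (x≢y ∘ suc-injective)
atMostTwo (true ∷ p)  (s≤s ∣p∣≤1) with ∣p∣≤1⇒p≡⊥⊎⁅x⁆ p ∣p∣≤1
... | inj₁ refl       = singleton zero
... | inj₂ (x , refl) =
  subst AtMostTwo (cong (true ∷_) (∪-identityˡ ⁅ x ⁆)) (pair {x = zero} {y = suc x} (λ ()))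

Increasing : ∀ {k} → (Fin (suc k) → Subset m) → Set
Increasing F = ∀ i → F (inject₁ i) ⊆ F (suc i)

increasing⇒F₀⊆ : ∀ {k} {F : Fin (suc k) → Subset m} → Increasing F → ∀ i → F zero ⊆ F i
increasing⇒F₀⊆                 inc zero    = ⊆-refl
increasing⇒F₀⊆ {k = suc _} {F} inc (suc i) =
  ⊆-trans (inc zero) (increasing⇒F₀⊆ {F = F ∘ suc} (inc ∘ suc) i)

increasing-mono : ∀ {k} {F : Fin (suc k) → Subset m} → Increasing F →
                  ∀ {i j : Fin k} → i < j → F (suc i) ⊆ F (inject₁ j)
increasing-mono {F = F} inc {zero}  {suc j} _         =
  increasing⇒F₀⊆ {F = F ∘ suc} (inc ∘ suc) (inject₁ j)
increasing-mono {F = F} inc {suc i} {suc j} (s≤s i<j) =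
  increasing-mono {F = F ∘ suc} (inc ∘ suc) i<j

increasing-separates : ∀ {k} {F : Fin (suc k) → Subset m} {x : Fin k → Fin m} → Increasing F →
                       (∀ i → x i ∈ F (suc i) × x i ∉ F (inject₁ i)) →
                       ∀ {i j} → i < j → x i ∈ F (suc i) × x j ∉ F (suc i)
increasing-separates {F = F} inc x-new {i} {j} i<j =
  proj₁ (x-new i) , λ xj∈ → proj₂ (x-new j) (increasing-mono {F = F} inc i<j xj∈)

module _ {n : ℕ} (K : SimplicialComplex n) where

  -- Reflexive: ⁅ x ⁆ ∪ ⁅ x ⁆ = ⁅ x ⁆ is a face.
  Adjacent : Fin n → Fin n → Set
  Adjacent x y = IsFace K (⁅ x ⁆ ∪ ⁅ y ⁆)

  EveryEdgeDominates : Set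
  EveryEdgeDominates = ∀ {c d} → c ≢ d → Adjacent c d → ∀ e → Adjacent c e ⊎ Adjacent d e

  Independent : Subset n → Set
  Independent I = ∀ {x y} → x ∈ I → y ∈ I → Adjacent x y → x ≡ y

  closedNeighbourhood : Fin n → Subset n
  closedNeighbourhood a = tabulate (λ x → H K (⁅ a ⁆ ∪ ⁅ x ⁆))

  ∁openNeighbourhood : Fin n → Subset n
  ∁openNeighbourhood a = ⁅ a ⁆ ∪ ∁ (closedNeighbourhood a)

module _ {n : ℕ} (K : SimplicialComplex n) where

  face⇒adjacent : ∀ {X} → IsFace K X → x ∈ X → y ∈ X → Adjacent K x y
  face⇒adjacent X∈K x∈X y∈X = downClosed K _ _ (x,y∈p⇒⁅x⁆∪⁅y⁆⊆p x∈X y∈X) X∈K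

  adjacent-sym : Adjacent K x y → Adjacent K y x
  adjacent-sym {x = x} {y} = downClosed K _ _ (⊆-reflexive (∪-comm ⁅ y ⁆ ⁅ x ⁆))

  X⊆⊥⇒X∪⁅x⁆-isFace : ∀ x {X} → X ⊆ ⊥ → IsFace K (X ∪ ⁅ x ⁆)
  X⊆⊥⇒X∪⁅x⁆-isFace x X⊆⊥ = downClosed K ⁅ x ⁆ _
    (λ y∈ → [ (λ y∈X → contradiction (X⊆⊥ y∈X) ∉⊥) , (λ y∈⁅x⁆ → y∈⁅x⁆) ] (x∈p∪q⁻ _ _ y∈))
    (singletons K x)

  ⊥-isFlat : IsFlat K ⊥
  ⊥-isFlat X _ X⊆⊥ p _ = X⊆⊥⇒X∪⁅x⁆-isFace p X⊆⊥

  ⊤-isFlat : IsFlat K ⊤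
  ⊤-isFlat _ _ _ _ p∉⊤ = contradiction ∈⊤ p∉⊤

  flat⇒adjacent : ∀ {G} → IsFlat K G → x ∈ G → y ∉ G → Adjacent K x y
  flat⇒adjacent G-flat x∈G y∉G = G-flat _ (singletons K _) (x∈p⇒⁅x⁆⊆p x∈G) _ y∉G

  ⊥-isTransversal : IsTransversalOfFlatChain K ⊥
  ⊥-isTransversal = 0 , (λ _ → ⊤) , (λ ()) , (λ _ → ⊤-isFlat) , (λ ()) , (λ ()) ,
    λ _ → mk⇔ (λ x∈⊥ → contradiction x∈⊥ ∉⊥) (λ { (() , _) })

  ⁅x⁆-isTransversal : ∀ x → IsTransversalOfFlatChain K ⁅ x ⁆
  ⁅x⁆-isTransversal x =
    1 , F , (λ _ → x) , F-flat , (λ { zero → ⊥⊆ , x , ∈⊤ , ∉⊥ }) , (λ { zero → ∈⊤ , ∉⊥ }) ,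
    λ y → mk⇔ (λ y∈⁅x⁆ → zero , sym (x∈⁅y⁆⇒x≡y x y∈⁅x⁆))
              (λ { (_ , refl) → x∈⁅x⁆ x })
    where
      F : Fin 2 → Subset n
      F zero       = ⊥
      F (suc zero) = ⊤
      F-flat : ∀ i → IsFlat K (F i)
      F-flat zero       = ⊥-isFlat
      F-flat (suc zero) = ⊤-isFlat

  ⁅x⁆∪⁅y⁆-isTransversal : ∀ {G} → IsFlat K G → x ∈ G → y ∉ G →
                          IsTransversalOfFlatChain K (⁅ x ⁆ ∪ ⁅ y ⁆)
  ⁅x⁆∪⁅y⁆-isTransversal {x = x} {y} {G} G-flat x∈G y∉G =
    2 , F , xs , F-flat , strict , (λ { zero → x∈G , ∉⊥ ; (suc zero) → ∈⊤ , y∉G }) ,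
    λ z → mk⇔ (λ z∈ → [ (λ z∈⁅x⁆ → zero , sym (x∈⁅y⁆⇒x≡y x z∈⁅x⁆))
                       , (λ z∈⁅y⁆ → suc zero , sym (x∈⁅y⁆⇒x≡y y z∈⁅y⁆)) ] (x∈p∪q⁻ _ _ z∈))
              (λ { (zero , refl) → x∈p∪q⁺ (inj₁ (x∈⁅x⁆ x))
                 ; (suc zero , refl) → x∈p∪q⁺ (inj₂ (x∈⁅x⁆ y)) })
    where
      F : Fin 3 → Subset n
      F zero             = ⊥
      F (suc zero)       = G
      F (suc (suc zero)) = ⊤
      xs : Fin 2 → Fin n
      xs zero       = x
      xs (suc zero) = y
      F-flat : ∀ i → IsFlat K (F i)
      F-flat zero             = ⊥-isFlat
      F-flat (suc zero)       = G-flat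
      F-flat (suc (suc zero)) = ⊤-isFlat
      strict : ∀ i → F (inject₁ i) ⊂ F (suc i)
      strict zero       = ⊥⊆ , x , x∈G , ∉⊥
      strict (suc zero) = ⊆⊤ , y , ∈⊤ , y∉G

  transversal-separates : ∀ {X c d} → IsTransversalOfFlatChain K X → c ∈ X → d ∈ X → c ≢ d →
                          ∃[ G ] IsFlat K G × (c ∈ G × d ∉ G ⊎ d ∈ G × c ∉ G)
  transversal-separates (_ , F , xs , F-flat , strict , xs-new , X⇔xs) c∈X d∈X c≢d
    with Equivalence.to (X⇔xs _) c∈X | Equivalence.to (X⇔xs _) d∈X
  ... | i , refl | j , refl with <-cmp i j
  ...   | tri< i<j _ _  = F (suc i) , F-flat (suc i) , inj₁ (separates i<j)
    where separates = increasing-separates {F = F} (proj₁ ∘ strict) xs-new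
  ...   | tri≈ _ refl _ = contradiction refl c≢d
  ...   | tri> _ _ j<i  = F (suc j) , F-flat (suc j) , inj₂ (separates j<i)
    where separates = increasing-separates {F = F} (proj₁ ∘ strict) xs-new

  separated⇒dominates : ∀ {G c d} → IsFlat K G → c ∈ G → d ∉ G →
                        ∀ e → Adjacent K c e ⊎ Adjacent K d e
  separated⇒dominates {G} G-flat c∈G d∉G e with e ∈? G
  ... | yes e∈G = inj₂ (adjacent-sym (flat⇒adjacent G-flat e∈G d∉G))
  ... | no  e∉G = inj₁ (flat⇒adjacent G-flat c∈G e∉G)

  BRSC⇒everyEdgeDominates : IsBRSC K → EveryEdgeDominates K
  BRSC⇒everyEdgeDominates K-brsc {c} {d} c≢d c~d e
    with transversal-separates (K-brsc _ c~d) (x∈p∪q⁺ (inj₁ (x∈⁅x⁆ c))) (x∈p∪q⁺ (inj₂ (x∈⁅x⁆ d))) c≢d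
  ... | _ , G-flat , inj₁ (c∈G , d∉G) = separated⇒dominates G-flat c∈G d∉G e
  ... | _ , G-flat , inj₂ (d∈G , c∉G) = swap (separated⇒dominates G-flat d∈G c∉G e)

  independent⇒isFlat : ∀ {I} → Independent K I → (∀ {x y} → x ∈ I → y ∉ I → Adjacent K x y) →
                       IsFlat K I
  independent⇒isFlat independent complete X X∈K X⊆I p p∉I with nonempty? X
  ... | no  X-empty   = X⊆⊥⇒X∪⁅x⁆-isFace p (⊆-reflexive (Empty-unique X-empty))
  ... | yes (q , q∈X) = downClosed K (⁅ q ⁆ ∪ ⁅ p ⁆) _
      (λ r∈ → x∈p∪q⁺ (Sum.map₁ X⊆⁅q⁆ (x∈p∪q⁻ _ _ r∈)))
      (complete (X⊆I q∈X) p∉I)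
    where
      X⊆⁅q⁆ : X ⊆ ⁅ q ⁆
      X⊆⁅q⁆ r∈X = subst (_∈ ⁅ q ⁆) (independent (X⊆I q∈X) (X⊆I r∈X) (face⇒adjacent X∈K q∈X r∈X))
                        (x∈⁅x⁆ q)

  module _ {a : Fin n} where

    a∈∁openNeighbourhood : a ∈ ∁openNeighbourhood K a
    a∈∁openNeighbourhood = x∈p∪q⁺ (inj₁ (x∈⁅x⁆ a))

    ∈∁openNeighbourhood⁻ : x ∈ ∁openNeighbourhood K a → x ≡ a ⊎ ¬ Adjacent K a x
    ∈∁openNeighbourhood⁻ x∈ = Sum.map (x∈⁅y⁆⇒x≡y a)
      (λ x∈∁ a~x → x∈∁p⇒x∉p x∈∁ (Equivalence.from x∈tabulate⇔T a~x)) (x∈p∪q⁻ _ _ x∈)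

    ∉∁openNeighbourhood⁻ : x ∉ ∁openNeighbourhood K a → x ≢ a × Adjacent K a x
    ∉∁openNeighbourhood⁻ x∉ =
      (λ { refl → x∉ a∈∁openNeighbourhood }) ,
      Equivalence.to x∈tabulate⇔T (x∉∁p⇒x∈p (λ x∈∁ → x∉ (x∈p∪q⁺ (inj₂ x∈∁))))

    ∉∁openNeighbourhood⁺ : x ≢ a → Adjacent K a x → x ∉ ∁openNeighbourhood K a
    ∉∁openNeighbourhood⁺ x≢a a~x x∈ = [ x≢a , (λ a≁x → a≁x a~x) ] (∈∁openNeighbourhood⁻ x∈)

  everyEdgeDominates⇒∁openNeighbourhood-isFlat : EveryEdgeDominates K → ∀ a →
                                                 IsFlat K (∁openNeighbourhood K a)
  everyEdgeDominates⇒∁openNeighbourhood-isFlat dominates a = independent⇒isFlat independent complete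
    where
      independent : Independent K (∁openNeighbourhood K a)
      independent {x} {y} x∈ y∈ x~y with ∈∁openNeighbourhood⁻ x∈ | ∈∁openNeighbourhood⁻ y∈
      ... | inj₁ refl | inj₁ refl = refl
      ... | inj₁ refl | inj₂ a≁y  = contradiction x~y a≁y
      ... | inj₂ a≁x  | inj₁ refl = contradiction (adjacent-sym x~y) a≁x
      ... | inj₂ a≁x  | inj₂ a≁y  with x ≟ y
      ...   | yes x≡y = x≡y
      ...   | no  x≢y = contradiction (dominates x≢y x~y a)
                          [ a≁x ∘ adjacent-sym , a≁y ∘ adjacent-sym ]
      complete : ∀ {x y} → x ∈ ∁openNeighbourhood K a → y ∉ ∁openNeighbourhood K a → Adjacent K x y
      complete {x} {y} x∈ y∉ with ∉∁openNeighbourhood⁻ y∉ | ∈∁openNeighbourhood⁻ x∈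
      ... | _   , a~y | inj₁ refl = a~y
      ... | y≢a , a~y | inj₂ a≁x  =
        [ (λ a~x → contradiction a~x a≁x) , adjacent-sym ] (dominates (y≢a ∘ sym) a~y x)

  dimension≤1∧everyEdgeDominates⇒BRSC : (∀ X → IsFace K X → ∣ X ∣ ≤ 2) → EveryEdgeDominates K →
                                       IsBRSC K
  dimension≤1∧everyEdgeDominates⇒BRSC dim≤1 dominates X X∈K =
    transversal X∈K (atMostTwo X (dim≤1 X X∈K))
    where
      transversal : ∀ {X} → IsFace K X → AtMostTwo X → IsTransversalOfFlatChain K X
      transversal _   empty         = ⊥-isTransversal
      transversal _   (singleton x) = ⁅x⁆-isTransversal x
      transversal a~b (pair a≢b)    = ⁅x⁆∪⁅y⁆-isTransversal
        (everyEdgeDominates⇒∁openNeighbourhood-isFlat dominates _) a∈∁openNeighbourhood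
        (∉∁openNeighbourhood⁺ (a≢b ∘ sym) a~b)

truncation-adjacent⇔ : ∀ {n k} {K K' : SimplicialComplex n} → 2 ≤ k → IsTruncation k K K' →
                       ∀ {x y} → Adjacent K x y ⇔ Adjacent K' x y
truncation-adjacent⇔ 2≤k K≡K'↾k {x} {y} = mk⇔
  (λ x~y → proj₁ (Equivalence.to (K≡K'↾k _) x~y))
  (λ x~'y → Equivalence.from (K≡K'↾k _) (x~'y , ≤-trans (∣⁅x⁆∪⁅y⁆∣≤2 x y) 2≤k))

truncation-everyEdgeDominates : ∀ {n k} {K K' : SimplicialComplex n} → 2 ≤ k → IsTruncation k K K' →
                                EveryEdgeDominates K' → EveryEdgeDominates K
truncation-everyEdgeDominates {K = K} {K'} 2≤k K≡K'↾k dominates c≢d c~d e =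
  Sum.map (Equivalence.from adjacent⇔) (Equivalence.from adjacent⇔)
          (dominates c≢d (Equivalence.to adjacent⇔ c~d) e)
  where
    adjacent⇔ : ∀ {x y} → Adjacent K x y ⇔ Adjacent K' x y
    adjacent⇔ = truncation-adjacent⇔ {K = K} {K'} 2≤k K≡K'↾k

proposition6p3 : ∀ (n : ℕ) (K : SimplicialComplex (suc n))
                 → HasDimension K 1 → IsTBRSC K → IsBRSC K
proposition6p3 n K ((X₀ , X₀∈K , ∣X₀∣≡2) , dim≤1) (k , _ , K' , K'-brsc , K≡K'↾k) =
  dimension≤1∧everyEdgeDominates⇒BRSC K dim≤1
    (truncation-everyEdgeDominates {K = K} {K'} 2≤k K≡K'↾k (BRSC⇒everyEdgeDominates K' K'-brsc))
  where
    2≤k : 2 ≤ k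
    2≤k = subst (_≤ k) ∣X₀∣≡2 (proj₂ (Equivalence.to (K≡K'↾k X₀) X₀∈K))
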